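{- Let $\mathcal G=(V,E)$ be a $k$-edge-colored hypergraph and fix a vertex $\alpha\in V$. For $1\le i\le k$ let $\mathcal G_i$ be the sub-hypergraph formed by the edges of color $i$, let $H_i$ be the set of hinges incident with $\alpha$ and with an edge of color $i$, and let $H^i=\bigcup\{H_W : W\in\mathscr W_\alpha(\mathcal G_i),\ d_W(\alpha)\ge 2\}$. For $e\in E$ let $H_e$ be the set of hinges incident with both $\alpha$ and $e$. Then $$\mathscr A=\{H_1,\dots,H_k\}\cup\{H^1,\dots,H^k\}\cup\{H_W : W\in\mathscr W_\alpha(\mathcal G_i),\ 1\le i\le k\}\cup\{H_e : e\in E\}$$ is a laminar family of subsets of $H(\alpha)$, i.e. for any $A,B\in\mathscr A$, either $A\subseteq B$, $B\subseteq A$, or $A\cap B=\varnothing$.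
   Context: A hypergraph is a pair $(V,E)$, $V$ finite, $E$ a multiset of edges, each edge a multi-subset of $V$ (each copy of an edge is a distinct edge). A $k$-edge-coloring assigns to each edge one of $k$ colors. Hinges: if $\alpha$ occurs with multiplicity $p$ in edge $e$, there are $p$ distinct hinges $h_1(\alpha,e),\dots,h_p(\alpha,e)$ incident with $\alpha$ and $e$; $H(\alpha)$ is the set of all hinges incident with $\alpha$. For a sub-hypergraph $W$, $H_W=H_W(\alpha)$ is the set of hinges at $\alpha$ belonging to edges of $W$, and $d_W(\alpha)=|H_W|$. A hypergraph is non-trivial if it has an edge; connected if any two vertices are joined by a sequence of vertices with consecutive ones in a common edge. A vertex $\alpha$ of a connected hypergraph $W$ is a cut vertex if there are non-trivial sub-hypergraphs $I,J$ with $I\cup J=W$, $V(I\cap J)=\{\alpha\}$, $E(I\cap J)=\varnothing$. For a hypergraph $\mathcal F$, an $\alpha$-wing of $\mathcal F$ is a non-trivial connected sub-hypergraph $W$ of $\mathcal F$ such that $\alpha$ is not a cut vertex of $W$ and no edge of $E(\mathcal F)\setminus E(W)$ is incident with a vertex of $V(W)\setminus\{\alpha\}$; $\mathscr W_\alpha(\mathcal F)$ is the set of all $\alpha$-wings of $\mathcal F$. -}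

module Defs where

open import Data.Nat using (ℕ; zero; suc; _+_; _≤_; _<_)
open import Data.Fin using (Fin; _≟_)
open import Data.Bool using (Bool; true; false; _∧_; _∨_; if_then_else_)
open import Data.List using (List; map; allFin)
open import Data.Nat.ListAction using (sum)
open import Data.Product using (Σ; ∃; _×_; _,_; proj₁)
open import Data.Sum using (_⊎_)
open import Data.Empty using (⊥)
open import Relation.Nullary using (¬_)
open import Relation.Nullary.Decidable using (⌊_⌋)
open import Relation.Binary.PropositionalEquality using (_≡_; _≢_)

-- A hypergraph on vertex set Fin n with edges indexed by Fin m (distinct indices
-- = distinct edges, so E is a multiset); edge e contains vertex v with
-- multiplicity (mult e v).
record Hypergraph (n m : ℕ) : Set where
  field
    mult : Fin m → Fin n → ℕ
open Hypergraph public

record ColoredHypergraph (n m k : ℕ) : Set where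
  field
    hg  : Hypergraph n m
    col : Fin m → Fin k
open ColoredHypergraph public

module _ {n m : ℕ} (G : Hypergraph n m) where

  record SubHG : Set where
    constructor sub
    field
      vs : Fin n → Bool
      es : Fin m → Bool
  open SubHG public

  Inc : Fin m → Fin n → Set
  Inc e v = 0 < mult G e v

  WellFormed : SubHG → Set
  WellFormed W = ∀ e v → es W e ≡ true → Inc e v → vs W v ≡ true

  _⊑_ : SubHG → SubHG → Set
  W ⊑ X = (∀ v → vs W v ≡ true → vs X v ≡ true) × (∀ e → es W e ≡ true → es X e ≡ true)

  IsSub : SubHG → SubHG → Set
  IsSub W X = WellFormed W × (W ⊑ X)

  NonTrivial : SubHG → Set
  NonTrivial W = ∃ λ e → es W e ≡ true

  data Path (W : SubHG) : Fin n → Fin n → Set where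
    here : ∀ {u} → Path W u u
    step : ∀ {u w v} (e : Fin m) → es W e ≡ true → Inc e u → Inc e w →
           Path W w v → Path W u v

  Connected : SubHG → Set
  Connected W = ∀ u v → vs W u ≡ true → vs W v ≡ true → Path W u v

  CutVertex : SubHG → Fin n → Set
  CutVertex W α = Σ SubHG λ I → Σ SubHG λ J →
      IsSub I W × IsSub J W × NonTrivial I × NonTrivial J ×
      (∀ v → vs W v ≡ (vs I v ∨ vs J v)) ×
      (∀ e → es W e ≡ (es I e ∨ es J e)) ×
      (∀ v → (vs I v ∧ vs J v) ≡ ⌊ v ≟ α ⌋) ×
      (∀ e → (es I e ∧ es J e) ≡ false)

  Wing : Fin n → SubHG → SubHG → Set
  Wing α F W =
      IsSub W F × NonTrivial W × Connected W × ¬ CutVertex W α ×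
      (∀ e v → es F e ≡ true → es W e ≡ false → vs W v ≡ true → v ≢ α → ¬ Inc e v)

  -- hinges incident with α: the j-th hinge (j < mult e α) of each edge e
  Hinge : Fin n → Set
  Hinge α = Σ (Fin m) λ e → Fin (mult G e α)

  deg : SubHG → Fin n → ℕ
  deg W α = sum (map (λ e → if es W e then mult G e α else 0) (allFin m))

  HW : (α : Fin n) → SubHG → Hinge α → Set
  HW α W h = es W (proj₁ h) ≡ true

module _ {n m k : ℕ} (𝒢 : ColoredHypergraph n m k) where

  private G = hg 𝒢

  Gcol : Fin k → SubHG G
  Gcol i = sub (λ _ → true) (λ e → ⌊ col 𝒢 e ≟ i ⌋)

  Hcol : (α : Fin n) → Fin k → Hinge G α → Set
  Hcol α i h = col 𝒢 (proj₁ h) ≡ i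

  Hup : (α : Fin n) → Fin k → Hinge G α → Set
  Hup α i h = Σ (SubHG G) λ W → Wing G α (Gcol i) W × 2 ≤ deg G W α × HW G α W h

  Hedge : (α : Fin n) → Fin m → Hinge G α → Set
  Hedge α e h = proj₁ h ≡ e

  data AIdx (α : Fin n) : Set where
    iCol  : Fin k → AIdx α
    iUp   : Fin k → AIdx α
    iWing : (i : Fin k) (W : SubHG G) → Wing G α (Gcol i) W → AIdx α
    iEdge : Fin m → AIdx α

  Aset : (α : Fin n) → AIdx α → Hinge G α → Set
  Aset α (iCol i)      = Hcol α i
  Aset α (iUp i)       = Hup α i
  Aset α (iWing i W _) = HW G α W
  Aset α (iEdge e)     = Hedge α e

LaminarPair : {X : Set} → (X → Set) → (X → Set) → Set
LaminarPair A B = (∀ x → A x → B x) ⊎ (∀ x → B x → A x) ⊎ (∀ x → A x → B x → ⊥)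

Laminar : {X I : Set} → (I → X → Set) → Set
Laminar {I = I} F = ∀ (a b : I) → LaminarPair (F a) (F b)

module Submission where

-- Every member of 𝒜 is a union of whole edges' hinge sets: it is the set of
-- hinges at α whose edge lies in some edge set (a colour class, the edges of
-- an α-wing, the edges of the α-wings of degree ≥ 2 of one colour, a single
-- edge).  So it suffices to show that these edge sets are pairwise laminar
-- once restricted to the edges incident with α.  Two facts about α-wings
-- drive this:
--   * uniqueness: two α-wings of the same hypergraph sharing an edge incident
--     with α have the same edges (otherwise the common part and the rest
--     would split one of them at the cut vertex α);
--   * existence: every edge e incident with α lies in an α-wing, namely the
--     edges reachable from e through vertices other than α.  Reachability in
--     a finite graph is decidable, which makes membership in H^i decidable.

open import Defs
open import Data.Nat using (ℕ; zero; suc; _+_; _≤_; _<_; s≤s; _≤?_; _<?_; >-nonZero⁻¹)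
open import Data.Nat.Properties using (≤-trans; <⇒≱; m≤m+n; +-suc; +-monoʳ-≤; ≤-reflexive)
open import Data.Fin using (Fin; _≟_)
open import Data.Fin.Properties using (any?; nonZeroIndex)
open import Data.Fin.Subset using (Subset; _∈_; _⊆_; ∣_∣; ⁅_⁆)
open import Data.Fin.Subset.Properties using (_∈?_; _⊂?_; ∣p∣≤n; p⊂q⇒∣p∣<∣q∣; x∈⁅x⁆; x∈⁅y⁆⇒x≡y)
open import Data.Bool using (true; false; _∧_; _∨_; not; if_then_else_) renaming (_≟_ to _≟ᵇ_)
open import Data.Bool.Properties
  using (T-≡; ∧-conicalˡ; ∧-conicalʳ; ∧-comm; ∨-comm; ∨-zeroʳ; ∨-identityʳ; not-injective)
open import Data.Vec using (tabulate)
open import Data.Vec.Properties using (lookup∘tabulate; []=⇒lookup; lookup⇒[]=)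
open import Data.List using (map; allFin)
open import Data.List.Properties using (map-cong)
open import Data.Nat.ListAction using (sum)
open import Data.Product using (Σ; ∃; _×_; _,_; proj₁; proj₂)
open import Data.Sum using (_⊎_; inj₁; inj₂; [_,_])
open import Data.Empty using (⊥-elim)
open import Function using (_∘_; id)
open import Function.Bundles using (Equivalence)
open import Level using (Level)
open import Relation.Nullary using (¬_; Dec; yes; no)
open import Relation.Nullary.Decidable using (⌊_⌋; toWitness; fromWitness; map′; _×-dec_; _⊎-dec_; ¬?)
open import Relation.Unary using (Pred) renaming (Decidable to Decidable¹)
open import Relation.Binary using (Rel; Decidable)
open import Relation.Binary.Construct.Closure.ReflexiveTransitive using (Star; ε; _◅_; _◅◅_)
open import Relation.Binary.PropositionalEquality
  using (_≡_; _≢_; refl; sym; trans; cong; cong₂; subst)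

private
  variable
    a ℓ : Level
    A : Set a

witness : {a? : Dec A} → ⌊ a? ⌋ ≡ true → A
witness p = toWitness (Equivalence.from T-≡ p)

decided : (a? : Dec A) → A → ⌊ a? ⌋ ≡ true
decided a? x = Equivalence.to T-≡ (fromWitness x)

∨-true : ∀ {x y} → (x ∨ y) ≡ true → x ≡ true ⊎ y ≡ true
∨-true {true}  _ = inj₁ refl
∨-true {false} p = inj₂ p

∧-true : ∀ {x y} → x ≡ true → y ≡ true → (x ∧ y) ≡ true
∧-true p q = cong₂ _∧_ p q

bool-ext : ∀ {x y} → (x ≡ true → y ≡ true) → (y ≡ true → x ≡ true) → x ≡ y
bool-ext {true}  {true}  _ _ = refl
bool-ext {true}  {false} x⇒y _ = sym (x⇒y refl)
bool-ext {false} {true}  _ y⇒x = y⇒x refl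
bool-ext {false} {false} _ _ = refl

true≢false : true ≢ false
true≢false ()

coe : {X Y : Set} → X ≡ Y → X → Y
coe = subst id

laminarPair-sym : {X : Set} {P Q : X → Set} → LaminarPair P Q → LaminarPair Q P
laminarPair-sym (inj₁ P⊆Q)        = inj₂ (inj₁ P⊆Q)
laminarPair-sym (inj₂ (inj₁ Q⊆P)) = inj₁ Q⊆P
laminarPair-sym (inj₂ (inj₂ P∩Q)) = inj₂ (inj₂ λ x q p → P∩Q x p q)

laminarPair-pullback : {X Y : Set} (g : X → Y) {A B : X → Set} {P Q : Y → Set} →
  (∀ x → A x ≡ P (g x)) → (∀ x → B x ≡ Q (g x)) → LaminarPair P Q → LaminarPair A B
laminarPair-pullback g A≡ B≡ (inj₁ P⊆Q) =
  inj₁ λ x → coe (sym (B≡ x)) ∘ P⊆Q (g x) ∘ coe (A≡ x)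
laminarPair-pullback g A≡ B≡ (inj₂ (inj₁ Q⊆P)) =
  inj₂ (inj₁ λ x → coe (sym (A≡ x)) ∘ Q⊆P (g x) ∘ coe (B≡ x))
laminarPair-pullback g A≡ B≡ (inj₂ (inj₂ P∩Q)) =
  inj₂ (inj₂ λ x p q → P∩Q (g x) (coe (A≡ x) p) (coe (B≡ x) q))

subsetOf : ∀ {n} {P : Pred (Fin n) ℓ} → Decidable¹ P → Subset n
subsetOf P? = tabulate (λ x → ⌊ P? x ⌋)

module _ {n} {P : Pred (Fin n) ℓ} (P? : Decidable¹ P) where

  ∈subsetOf⁺ : ∀ {x} → P x → x ∈ subsetOf P?
  ∈subsetOf⁺ {x} px = lookup⇒[]= x (subsetOf P?) (trans (lookup∘tabulate _ x) (decided (P? x) px))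

  ∈subsetOf⁻ : ∀ {x} → x ∈ subsetOf P? → P x
  ∈subsetOf⁻ {x} x∈ = witness {a? = P? x} (trans (sym (lookup∘tabulate _ x)) ([]=⇒lookup x∈))

-- Iterating an inflationary operator on subsets of Fin m from a start satisfying
-- an invariant reaches, within m steps, a closed subset (next q ⊆ q) that still
-- satisfies the invariant: every non-closing step strictly grows the subset.
module _ {m} (next : Subset m → Subset m) (inflationary : ∀ p → p ⊆ next p)
         (Inv : Subset m → Set ℓ) (preserved : ∀ {p} → Inv p → Inv (next p)) where

  private
    closedFrom : ∀ fuel p → m < fuel + ∣ p ∣ → Inv p → ∃ λ q → Inv q × next q ⊆ q
    closedFrom zero       p bound inv = ⊥-elim (<⇒≱ bound (∣p∣≤n p))
    closedFrom (suc fuel) p bound inv with p ⊂? next p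
    ... | yes p⊂next = closedFrom fuel (next p) bound′ (preserved inv)
      where
      bound′ : m < fuel + ∣ next p ∣
      bound′ = ≤-trans bound (≤-trans (≤-reflexive (sym (+-suc fuel ∣ p ∣)))
                                      (+-monoʳ-≤ fuel (p⊂q⇒∣p∣<∣q∣ p⊂next)))
    ... | no ¬p⊂next = p , inv , closed
      where
      closed : next p ⊆ p
      closed {x} x∈next with x ∈? p
      ... | yes x∈p = x∈p
      ... | no  x∉p = ⊥-elim (¬p⊂next (inflationary p , x , x∈next , x∉p))

  closedSubset : ∀ {p} → Inv p → ∃ λ q → Inv q × next q ⊆ q
  closedSubset {p} = closedFrom (suc m) p (s≤s (m≤m+n m ∣ p ∣))

star-ind : {I : Set} {R : Rel I ℓ} {e : I} (P : I → Set a) → P e →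
  (∀ {g f} → Star R e f → R g f → P g → P f) → ∀ {f} → Star R e f → P f
star-ind {R = R} {e} P pe carry = go ε pe
  where
  go : ∀ {g f} → Star R e g → P g → Star R g f → P f
  go e→g pg ε          = pg
  go e→g pg (r ◅ g→f) = go e→f (carry e→f r pg) g→f
    where e→f = e→g ◅◅ (r ◅ ε)

-- Reachability in a finite graph with decidable edges is decidable: the closed
-- subset generated from {e} by adding successors is exactly the reachable set.
module _ {m} {Adj : Rel (Fin m) ℓ} (Adj? : Decidable Adj) (e : Fin m) where

  private
    next : Subset m → Subset m
    next p = subsetOf (λ f → f ∈? p ⊎-dec any? (λ g → g ∈? p ×-dec Adj? g f))

    Sound : Subset m → Set ℓ
    Sound p = e ∈ p × (∀ {f} → f ∈ p → Star Adj e f)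

    next-sound : ∀ {p} → Sound p → Sound (next p)
    next-sound (e∈p , reach) =
      ∈subsetOf⁺ _ (inj₁ e∈p) ,
      λ f∈ → [ reach , (λ { (g , g∈p , g→f) → reach g∈p ◅◅ (g→f ◅ ε) }) ] (∈subsetOf⁻ _ f∈)

    start-sound : Sound ⁅ e ⁆
    start-sound = x∈⁅x⁆ e , λ f∈ → subst (Star Adj e) (sym (x∈⁅y⁆⇒x≡y e f∈)) ε

    closure : ∃ λ q → Sound q × next q ⊆ q
    closure = closedSubset next (λ p x∈p → ∈subsetOf⁺ _ (inj₁ x∈p)) Sound next-sound start-sound

    q : Subset m
    q = proj₁ closure

    e∈q : e ∈ q
    e∈q = proj₁ (proj₁ (proj₂ closure))

    sound : ∀ {f} → f ∈ q → Star Adj e f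
    sound = proj₂ (proj₁ (proj₂ closure))

    closed : next q ⊆ q
    closed = proj₂ (proj₂ closure)

    complete : ∀ {f} → Star Adj e f → f ∈ q
    complete = star-ind (_∈ q) e∈q (λ _ g→f g∈q → closed (∈subsetOf⁺ _ (inj₂ (_ , g∈q , g→f))))

  -- Opaque: used only through its type; unfolding it would make the type
  -- checker evaluate the closure computation.
  opaque
    reachable? : ∀ f → Dec (Star Adj e f)
    reachable? f = map′ sound complete (f ∈? q)

module _ {n m} {G : Hypergraph n m} {W : SubHG G} where

  path-snoc : ∀ {u w v} → Path G W u w → (e : Fin m) → es W e ≡ true →
    Inc G e w → Inc G e v → Path G W u v
  path-snoc here                 e e∈W ew ev = step e e∈W ew ev here
  path-snoc (step f f∈W fu fw p) e e∈W ew ev = step f f∈W fu fw (path-snoc p e e∈W ew ev)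

  path-reverse : ∀ {u v} → Path G W u v → Path G W v u
  path-reverse here                 = here
  path-reverse (step e e∈W eu ew p) = path-snoc (path-reverse p) e e∈W ew eu

  path-append : ∀ {u w v} → Path G W u w → Path G W w v → Path G W u v
  path-append here                 q = q
  path-append (step e e∈W eu ew p) q = step e e∈W eu ew (path-append p q)

  connected-via : (α : Fin n) → (∀ u → vs W u ≡ true → Path G W u α) → Connected G W
  connected-via α to-α u v u∈W v∈W = path-append (to-α u u∈W) (path-reverse (to-α v v∈W))

deg-cong : ∀ {n m} (G : Hypergraph n m) (W W′ : SubHG G) α →
  (∀ f → es W f ≡ es W′ f) → deg G W α ≡ deg G W′ α
deg-cong G W W′ α same =
  cong sum (map-cong (λ f → cong (λ b → if b then mult G f α else 0) (same f)) (allFin _))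

module Wings {n m} (G : Hypergraph n m) (α : Fin n) where

  module _ {F W : SubHG G} (w : Wing G α F W) where

    wing-wellFormed : WellFormed G W
    wing-wellFormed = proj₁ (proj₁ w)

    wing-edges⊆ : ∀ f → es W f ≡ true → es F f ≡ true
    wing-edges⊆ = proj₂ (proj₂ (proj₁ w))

    wing-noCut : ¬ CutVertex G W α
    wing-noCut = proj₁ (proj₂ (proj₂ (proj₂ w)))

    wing-closed : ∀ f v → es F f ≡ true → es W f ≡ false → vs W v ≡ true → v ≢ α → ¬ Inc G f v
    wing-closed = proj₂ (proj₂ (proj₂ (proj₂ w)))

  -- If α-wings W, W′ of F share an edge e at α but some edge f of W is not in
  -- W′, then α cuts W into the part inside W′ and the part outside W′: a
  -- vertex ≠ α of W on an edge of W outside W′ cannot lie in W′, since W′ is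
  -- closed in F.
  cut-by-wing : ∀ {F W W′} → Wing G α F W → Wing G α F W′ →
    ∀ e → es W e ≡ true → es W′ e ≡ true → Inc G e α →
    ∀ f → es W f ≡ true → es W′ f ≡ false → CutVertex G W α
  cut-by-wing {F} {W} {W′} w w′ e e∈W e∈W′ eα f f∈W f∉W′ =
    I , J , (I-wf , (λ _ → ∧-conicalˡ _ _) , (λ _ → ∧-conicalˡ _ _))
          , (J-wf , (λ _ → ∧-conicalˡ _ _) , (λ _ → ∧-conicalˡ _ _))
          , (e , ∧-true e∈W e∈W′) , (f , ∧-true f∈W (trans (∨-identityʳ _) (cong not f∉W′)))
          , (λ v → split (vs W v) (vs W′ v) ⌊ v ≟ α ⌋)
          , (λ g → split (es W g) (es W′ g) false)
          , meet-at-α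
          , (λ g → apart (es W g) (es W′ g))
    where
    -- I: the part of W inside W′; J: the part outside W′ together with α.
    -- J's edge marking has the shape of its vertex marking with no exception.
    I J : SubHG G
    I = sub (λ v → vs W v ∧ vs W′ v) (λ g → es W g ∧ es W′ g)
    J = sub (λ v → vs W v ∧ (not (vs W′ v) ∨ ⌊ v ≟ α ⌋)) (λ g → es W g ∧ (not (es W′ g) ∨ false))

    split : ∀ x y b → x ≡ ((x ∧ y) ∨ (x ∧ (not y ∨ b)))
    split true true  b = refl
    split true false b = refl
    split false y    b = refl

    apart : ∀ x y → ((x ∧ y) ∧ (x ∧ (not y ∨ false))) ≡ false
    apart true true  = refl
    apart true false = refl
    apart false y    = refl

    α∈W : vs W α ≡ true
    α∈W = wing-wellFormed w e α e∈W eα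

    α∈W′ : vs W′ α ≡ true
    α∈W′ = wing-wellFormed w′ e α e∈W′ eα

    meet-at-α : ∀ v → ((vs W v ∧ vs W′ v) ∧ (vs W v ∧ (not (vs W′ v) ∨ ⌊ v ≟ α ⌋))) ≡ ⌊ v ≟ α ⌋
    meet-at-α v with v ≟ α
    ... | yes refl = cong₂ (λ x y → (x ∧ y) ∧ (x ∧ (not y ∨ true))) α∈W α∈W′
    ... | no  _    = apart (vs W v) (vs W′ v)

    I-wf : WellFormed G I
    I-wf g v g∈I gv = ∧-true (wing-wellFormed w g v (∧-conicalˡ _ _ g∈I) gv)
                              (wing-wellFormed w′ g v (∧-conicalʳ _ _ g∈I) gv)

    J-wf : WellFormed G J
    J-wf g v g∈J gv = ∧-true (wing-wellFormed w g v g∈W gv) outside-W′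
      where
      g∈W : es W g ≡ true
      g∈W = ∧-conicalˡ _ _ g∈J

      g∉W′ : es W′ g ≡ false
      g∉W′ = not-injective (trans (sym (∨-identityʳ _)) (∧-conicalʳ _ _ g∈J))

      -- v is outside W′ unless v = α, since W′ is closed in F
      outside-W′ : (not (vs W′ v) ∨ ⌊ v ≟ α ⌋) ≡ true
      outside-W′ with v ≟ α | vs W′ v in v∈?W′
      ... | yes _  | _     = ∨-zeroʳ _
      ... | no  _  | false = refl
      ... | no v≢α | true  = ⊥-elim (wing-closed w′ g v (wing-edges⊆ w g g∈W) g∉W′ v∈?W′ v≢α gv)

  wings-nest : ∀ {F W W′} → Wing G α F W → Wing G α F W′ →
    ∀ e → es W e ≡ true → es W′ e ≡ true → Inc G e α → ∀ f → es W f ≡ true → es W′ f ≡ true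
  wings-nest {W′ = W′} w w′ e e∈W e∈W′ eα f f∈W with es W′ f in f∈?W′
  ... | true  = refl
  ... | false = ⊥-elim (wing-noCut w (cut-by-wing w w′ e e∈W e∈W′ eα f f∈W f∈?W′))

  wings-unique : ∀ {F W W′} → Wing G α F W → Wing G α F W′ →
    ∀ e → es W e ≡ true → es W′ e ≡ true → Inc G e α → ∀ f → es W f ≡ es W′ f
  wings-unique w w′ e e∈W e∈W′ eα f =
    bool-ext (wings-nest w w′ e e∈W e∈W′ eα f) (wings-nest w′ w e e∈W′ e∈W eα f)

  -- Existence: in a sub-hypergraph F, an edge e of F at α lies in the α-wing
  -- whose edges are those reachable from e by passing from one edge of F to
  -- another through a common vertex other than α, and whose vertices are α
  -- and the vertices of these edges.
  module WingThrough {F : SubHG G} (F-wf : WellFormed G F)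
                     {e : Fin m} (e∈F : es F e ≡ true) (eα : Inc G e α) where

    Adj : Rel (Fin m) _
    Adj g f = es F f ≡ true × ∃ λ w → w ≢ α × Inc G g w × Inc G f w

    adj? : Decidable Adj
    adj? g f = (es F f ≟ᵇ true) ×-dec
               any? (λ w → ¬? (w ≟ α) ×-dec (0 <? mult G g w) ×-dec (0 <? mult G f w))

    Reach : Fin m → Set
    Reach = Star Adj e

    reach? : ∀ f → Dec (Reach f)
    reach? = reachable? adj? e

    Touched : Fin n → Set
    Touched v = v ≡ α ⊎ ∃ λ g → Reach g × Inc G g v

    touched? : ∀ v → Dec (Touched v)
    touched? v = (v ≟ α) ⊎-dec any? (λ g → reach? g ×-dec (0 <? mult G g v))

    W : SubHG G
    W = sub (λ v → ⌊ touched? v ⌋) (λ f → ⌊ reach? f ⌋)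

    reach∈W : ∀ {f} → Reach f → es W f ≡ true
    reach∈W {f} = decided (reach? f)

    e∈W : es W e ≡ true
    e∈W = reach∈W ε

    reach⊆F : ∀ {f} → Reach f → es F f ≡ true
    reach⊆F = star-ind (λ f → es F f ≡ true) e∈F (λ _ g→f _ → proj₁ g→f)

    W-wf : WellFormed G W
    W-wf g v g∈W gv = decided (touched? v) (inj₂ (g , witness g∈W , gv))

    W⊑F : _⊑_ G W F
    W⊑F = (λ v v∈W → vertex⊆F (witness v∈W)) , (λ f f∈W → reach⊆F (witness f∈W))
      where
      vertex⊆F : ∀ {v} → Touched v → vs F v ≡ true
      vertex⊆F     (inj₁ refl)         = F-wf e α e∈F eα
      vertex⊆F {v} (inj₂ (g , rg , gv)) = F-wf g v (reach⊆F rg) gv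

    edge-to-α : ∀ {g} → Reach g → ∀ {u} → Inc G g u → Path G W u α
    edge-to-α = star-ind (λ g → ∀ {u} → Inc G g u → Path G W u α)
      (λ eu → step e e∈W eu eα here)
      (λ e→f (_ , w , _ , gw , fw) to-α fu → step _ (reach∈W e→f) fu fw (to-α gw))

    W-connected : Connected G W
    W-connected = connected-via α λ u u∈W → vertex-to-α (witness u∈W)
      where
      vertex-to-α : ∀ {u} → Touched u → Path G W u α
      vertex-to-α (inj₁ refl)          = here
      vertex-to-α (inj₂ (g , rg , gu)) = edge-to-α rg gu

    -- In a split of W at α, the side containing e contains every reachable
    -- edge: consecutive edges share a vertex ≠ α, which cannot lie on both sides.
    side-of-e : (I J : SubHG G) → WellFormed G I → WellFormed G J →
      (∀ f → es W f ≡ (es I f ∨ es J f)) → (∀ v → (vs I v ∧ vs J v) ≡ ⌊ v ≟ α ⌋) →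
      es I e ≡ true → ∀ {f} → Reach f → es I f ≡ true
    side-of-e I J I-wf J-wf cover meet e∈I = star-ind (λ f → es I f ≡ true) e∈I carry
      where
      carry : ∀ {g f} → Reach f → Adj g f → es I g ≡ true → es I f ≡ true
      carry {g} {f} e→f (_ , w , w≢α , gw , fw) g∈I
        with ∨-true (trans (sym (cover f)) (reach∈W e→f))
      ... | inj₁ f∈I = f∈I
      ... | inj₂ f∈J = ⊥-elim (w≢α (witness (trans (sym (meet w))
                         (∧-true (I-wf g w g∈I gw) (J-wf f w f∈J fw)))))

    -- so the other side has no edges, contradicting non-triviality
    W-noCut : ¬ CutVertex G W α
    W-noCut (I , J , (I-wf , _) , (J-wf , _) , (i , i∈I) , (j , j∈J) , _ , cover , meet , disjoint)
      with ∨-true (trans (sym (cover e)) e∈W)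
    ... | inj₁ e∈I = true≢false (trans (sym (∧-true j∈I j∈J)) (disjoint j))
      where
      j∈I = side-of-e I J I-wf J-wf cover meet e∈I
              (witness (trans (cover j) (trans (cong (es I j ∨_) j∈J) (∨-zeroʳ _))))
    ... | inj₂ e∈J = true≢false (trans (sym (∧-true i∈I i∈J)) (disjoint i))
      where
      i∈J = side-of-e J I J-wf I-wf (λ f → trans (cover f) (∨-comm (es I f) (es J f)))
              (λ v → trans (∧-comm (vs J v) (vs I v)) (meet v)) e∈J
              (witness (trans (cover i) (cong (_∨ es J i) i∈I)))

    -- an edge of F meeting W outside α is reachable, hence in W
    W-closed : ∀ f v → es F f ≡ true → es W f ≡ false → vs W v ≡ true → v ≢ α → ¬ Inc G f v
    W-closed f v f∈F f∉W v∈W v≢α fv with witness {a? = touched? v} v∈W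
    ... | inj₁ v≡α          = v≢α v≡α
    ... | inj₂ (g , rg , gv) = true≢false (trans (sym (reach∈W (rg ◅◅ (g→f ◅ ε)))) f∉W)
      where g→f = f∈F , v , v≢α , gv , fv

    wing : Wing G α F W
    wing = (W-wf , W⊑F) , (e , e∈W) , W-connected , W-noCut , W-closed

  wing-through : ∀ {F} → WellFormed G F → ∀ {e} → es F e ≡ true → Inc G e α →
    ∃ λ W → Wing G α F W × es W e ≡ true
  wing-through F-wf e∈F eα = W , wing , e∈W
    where open WingThrough F-wf e∈F eα

module Laminarity {n m k} (𝒢 : ColoredHypergraph n m k) (α : Fin n) where

  G : Hypergraph n m
  G = hg 𝒢

  open Wings G α

  -- The edge set behind each member of 𝒜: the member is the set of hinges at
  -- α whose edge lies in it.
  EdgeSet : AIdx 𝒢 α → Fin m → Set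
  EdgeSet (iCol i)      f = col 𝒢 f ≡ i
  EdgeSet (iUp i)       f = Σ (SubHG G) λ W → Wing G α (Gcol 𝒢 i) W × 2 ≤ deg G W α × es W f ≡ true
  EdgeSet (iWing _ W _) f = es W f ≡ true
  EdgeSet (iEdge e)     f = f ≡ e

  Aset-edges : ∀ a h → Aset 𝒢 α a h ≡ EdgeSet a (proj₁ h)
  Aset-edges (iCol _)      _ = refl
  Aset-edges (iUp _)       _ = refl
  Aset-edges (iWing _ _ _) _ = refl
  Aset-edges (iEdge _)     _ = refl

  AEdge : Set
  AEdge = Σ (Fin m) λ f → Inc G f α

  hinge-edge : Hinge G α → AEdge
  hinge-edge (f , j) = f , >-nonZero⁻¹ _ {{nonZeroIndex j}}

  EdgeLaminar : (Fin m → Set) → (Fin m → Set) → Set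
  EdgeLaminar P Q = LaminarPair {X = AEdge} (P ∘ proj₁) (Q ∘ proj₁)

  Coloured : (Fin m → Set) → Fin k → Set
  Coloured P i = ∀ f → P f → col 𝒢 f ≡ i

  wing-coloured : ∀ {i W} → Wing G α (Gcol 𝒢 i) W → Coloured (λ f → es W f ≡ true) i
  wing-coloured w f f∈W = witness (wing-edges⊆ w f f∈W)

  up-coloured : ∀ i → Coloured (EdgeSet (iUp i)) i
  up-coloured i f (W , w , _ , f∈W) = wing-coloured w f f∈W

  colours-disjoint : ∀ {P Q i j} → i ≢ j → Coloured P i → Coloured Q j → EdgeLaminar P Q
  colours-disjoint i≢j P⊆i Q⊆j = inj₂ (inj₂ λ (f , _) p q → i≢j (trans (sym (P⊆i f p)) (Q⊆j f q)))

  colour-class : ∀ i {Q j} → Coloured Q j → EdgeLaminar (EdgeSet (iCol i)) Q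
  colour-class i {j = j} Q⊆j with i ≟ j
  ... | yes refl = inj₂ (inj₁ λ (f , _) → Q⊆j f)
  ... | no  i≢j  = colours-disjoint i≢j (λ _ → id) Q⊆j

  -- By uniqueness, an edge f at α of an α-wing W of G_i lies in H^i only if
  -- d_W(α) ≥ 2: the wing witnessing f ∈ H^i has the edges of W.
  up→deg : ∀ {i W f} → Wing G α (Gcol 𝒢 i) W → es W f ≡ true → Inc G f α →
    EdgeSet (iUp i) f → 2 ≤ deg G W α
  up→deg {W = W} w f∈W fα (W′ , w′ , 2≤deg , f∈W′) =
    subst (2 ≤_) (deg-cong G W′ W α (wings-unique w′ w _ f∈W′ f∈W fα)) 2≤deg

  -- Membership of an edge at α in H^i is decided by the degree of the α-wing
  -- through it, which exists.
  up? : ∀ i f → Inc G f α → Dec (EdgeSet (iUp i) f)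
  up? i f fα with col 𝒢 f ≟ i
  ... | no  f∉i = no (f∉i ∘ up-coloured i f)
  ... | yes f∈i with wing-through (λ _ _ _ _ → refl) (decided (col 𝒢 f ≟ i) f∈i) fα
  ...   | W , w , f∈W = map′ (λ 2≤deg → W , w , 2≤deg , f∈W) (up→deg w f∈W fα) (2 ≤? deg G W α)

  edgeSet? : ∀ b f → Inc G f α → Dec (EdgeSet b f)
  edgeSet? (iCol i)      f _  = col 𝒢 f ≟ i
  edgeSet? (iUp i)       f fα = up? i f fα
  edgeSet? (iWing _ W _) f _  = es W f ≟ᵇ true
  edgeSet? (iEdge e)     f _  = f ≟ e

  single-edge : ∀ e b → EdgeLaminar (EdgeSet (iEdge e)) (EdgeSet b)
  single-edge e b with 0 <? mult G e α
  ... | no ¬eα = inj₂ (inj₂ λ { (f , fα) refl _ → ¬eα fα })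
  ... | yes eα with edgeSet? b e eα
  ...   | yes e∈b = inj₁ λ { (f , _) refl → e∈b }
  ...   | no  e∉b = inj₂ (inj₂ λ { (f , _) refl e∈b → e∉b e∈b })

  up-up : ∀ i j → EdgeLaminar (EdgeSet (iUp i)) (EdgeSet (iUp j))
  up-up i j with i ≟ j
  ... | yes refl = inj₁ λ _ → id
  ... | no  i≢j  = colours-disjoint i≢j (up-coloured i) (up-coloured j)

  up-wing : ∀ i j W (w : Wing G α (Gcol 𝒢 j) W) → EdgeLaminar (EdgeSet (iUp i)) (EdgeSet (iWing j W w))
  up-wing i j W w with i ≟ j
  ... | no  i≢j  = colours-disjoint i≢j (up-coloured i) (wing-coloured w)
  ... | yes refl with 2 ≤? deg G W α
  ...   | yes 2≤deg = inj₂ (inj₁ λ _ f∈W → W , w , 2≤deg , f∈W)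
  ...   | no  deg<2 = inj₂ (inj₂ λ (f , fα) f∈up f∈W → deg<2 (up→deg w f∈W fα f∈up))

  wing-wing : ∀ i W (w : Wing G α (Gcol 𝒢 i) W) j W′ (w′ : Wing G α (Gcol 𝒢 j) W′) →
    EdgeLaminar (EdgeSet (iWing i W w)) (EdgeSet (iWing j W′ w′))
  wing-wing i W w j W′ w′ with i ≟ j
  ... | no  i≢j  = colours-disjoint i≢j (wing-coloured w) (wing-coloured w′)
  ... | yes refl with any? (λ f → (es W f ≟ᵇ true) ×-dec (es W′ f ≟ᵇ true) ×-dec (0 <? mult G f α))
  ...   | yes (e , e∈W , e∈W′ , eα) = inj₁ λ (f , _) → wings-nest w w′ e e∈W e∈W′ eα f
  ...   | no  ¬shared = inj₂ (inj₂ λ (f , fα) f∈W f∈W′ → ¬shared (f , f∈W , f∈W′ , fα))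

  edge-laminar : ∀ a b → EdgeLaminar (EdgeSet a) (EdgeSet b)
  edge-laminar (iEdge e)     b             = single-edge e b
  edge-laminar a             (iEdge e)     = laminarPair-sym (single-edge e a)
  edge-laminar (iCol i)      (iCol j)      = colour-class i (λ _ → id)
  edge-laminar (iCol i)      (iUp j)       = colour-class i (up-coloured j)
  edge-laminar (iCol i)      (iWing j W w) = colour-class i (wing-coloured w)
  edge-laminar (iUp i)       (iCol j)      = laminarPair-sym (colour-class j (up-coloured i))
  edge-laminar (iWing i W w) (iCol j)      = laminarPair-sym (colour-class j (wing-coloured w))
  edge-laminar (iUp i)       (iUp j)       = up-up i j
  edge-laminar (iUp i)       (iWing j W w) = up-wing i j W w
  edge-laminar (iWing j W w) (iUp i)       = laminarPair-sym (up-wing i j W w)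
  edge-laminar (iWing i W w) (iWing j W′ w′) = wing-wing i W w j W′ w′

lemma2p2 : ∀ {n m k : ℕ} (𝒢 : ColoredHypergraph n m k) (α : Fin n) →
    Laminar (Aset 𝒢 α)
lemma2p2 𝒢 α a b =
  laminarPair-pullback hinge-edge (Aset-edges a) (Aset-edges b) (edge-laminar a b)
  where open Laminarity 𝒢 α
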